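{- Let $H=(V,\mathcal E)$ be a hypergraph whose vertices are revealed online in the order $v_1,\ldots,v_n$, and let $V_t=\{v_1,\ldots,v_t\}$. Consider the following online framework, with a fixed integer $h\ge1$, auxiliary colors $A=\{a_1,\ldots,a_h\}$ and a function $f:\mathbb N^+\to A$. A table is maintained with entries $i=1,2,\ldots$; entry $i$ stores at time $t$ a set $V^i_t\subseteq V_t$ (initially empty) together with an auxiliary coloring of $V^i_t$ by colors from $A$. When $v_t$ is revealed, entries $i=1,2,\ldots$ are processed in order: if there is an auxiliary color $c\in A$ (chosen by some arbitrary rule) such that the auxiliary coloring of $V^i_{t-1}$ extended by $v_t\mapsto c$ is a proper coloring of the induced hypergraph $H(V^i_{t-1}\cup\{v_t\})$, then $v_t$ is added to entry $i$ with color $c$ (so $V^i_t=V^i_{t-1}\cup\{v_t\}$); if moreover $c=f(i)$, $v_t$ receives the final color $i$ and the process for $v_t$ stops. Otherwise (no such $c$, or $c\ne f(i)$) entry $i$ receives $v_t$ only as described and the process continues with entry $i+1$; entries not reached are unchanged. If this process halts (assigns a final color) for every vertex, then for every $t=1,\ldots,n$ the final coloring restricted to $V_t$ is a conflict-free coloring of the induced hypergraph $H(V_t)$.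
   Context: For $V'\subseteq V$, the induced hypergraph is $H(V')=(V',\{S\cap V': S\in\mathcal E\})$. A coloring is proper if every hyperedge with at least two vertices is non-monochromatic. A coloring is conflict-free if every non-empty hyperedge contains a vertex whose color is different from the colors of all other vertices of that hyperedge. Colors, once assigned, are never changed. -}

module Defs where

open import Data.Nat using (ℕ; zero; suc; _<_; _≤_)
open import Data.Fin using (Fin; toℕ; _≟_)
open import Data.Fin.Subset using (Subset; _∈_)
open import Data.Maybe using (Maybe; just; nothing)
open import Data.Product using (Σ; ∃; ∃₂; _×_; _,_)
open import Data.Sum using (_⊎_)
open import Relation.Binary.PropositionalEquality using (_≡_; _≢_)
open import Relation.Nullary using (¬_; yes; no)

-- A hypergraph on the vertex set V = Fin n; vertex v_{t+1} is the Fin-index t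
-- (revelation order v_1,...,v_n = 0,...,n-1).  Hyperedges are indexed by an
-- arbitrary type Edge.
record Hypergraph (n : ℕ) : Set₁ where
  field
    Edge : Set
    edge : Edge → Subset n
open Hypergraph public

PartialColoring : ℕ → Set → Set
PartialColoring n C = Fin n → Maybe C

InDom : ∀ {n} {C : Set} → PartialColoring n C → Fin n → Set
InDom col v = ∃ λ c → col v ≡ just c

Proper : ∀ {n} {C : Set} → Hypergraph n → PartialColoring n C → Set
Proper H col =
  ∀ e →
  (∃₂ λ u w → u ≢ w × u ∈ edge H e × w ∈ edge H e × InDom col u × InDom col w) →
  ¬ (∃ λ c → ∀ u → u ∈ edge H e → InDom col u → col u ≡ just c)

extend : ∀ {n} {C : Set} → PartialColoring n C → Fin n → C → PartialColoring n C
extend col v c u with u ≟ v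
... | yes _ = just c
... | no  _ = col u

Unchanged : ∀ {n} {C : Set} → PartialColoring n C → PartialColoring n C → Set
Unchanged old new = ∀ u → new u ≡ old u

Added : ∀ {n} {C : Set} → Fin n → C → PartialColoring n C → PartialColoring n C → Set
Added v c old new = ∀ u → new u ≡ extend old v c u

-- How entry i (0-based; entry i here is entry i+1 of the paper) changes when
-- vertex v is processed, given that v receives final colour k (process stops at entry k).
-- f i ∈ Fin h is the paper's f(i+1).
EntryUpdate : ∀ {n h} → Hypergraph n → (ℕ → Fin h) → Fin n → (k i : ℕ) →
              PartialColoring n (Fin h) → PartialColoring n (Fin h) → Set
EntryUpdate H f v k i old new =
    (i < k ×
      ((¬ (∃ λ c → Proper H (extend old v c)) × Unchanged old new)
       ⊎ (∃ λ c → Proper H (extend old v c) × c ≢ f i × Added v c old new)))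
  ⊎ (i ≡ k × Proper H (extend old v (f i)) × Added v (f i) old new)
  ⊎ (k < i × Unchanged old new)

-- A halting run of the online framework (with an arbitrary choice rule,
-- modelled nondeterministically). aux t i = auxiliary colouring of entry i at
-- time t (domain V^i_t); final v = final colour of v.
record Run {n h : ℕ} (H : Hypergraph n) (f : ℕ → Fin h) : Set where
  field
    aux   : ℕ → ℕ → PartialColoring n (Fin h)
    final : Fin n → ℕ
    init  : ∀ i u → aux 0 i u ≡ nothing
    step  : ∀ (v : Fin n) i →
            EntryUpdate H f v (final v) i (aux (toℕ v) i) (aux (suc (toℕ v)) i)
open Run public

ConflictFreeOn : ∀ {n} {C : Set} → Hypergraph n → (Fin n → Set) → (Fin n → C) → Set
ConflictFreeOn H D χ =
  ∀ e → (∃ λ u → u ∈ edge H e × D u) →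
  ∃ λ u → u ∈ edge H e × D u ×
    (∀ w → w ∈ edge H e → D w → w ≢ u → χ w ≢ χ u)

-- Among the vertices of a hyperedge e present at time t, take one, u, of maximal
-- final colour k. If another such vertex had final colour k, let b be the later of
-- the two. Every vertex of e in entry k just before b joins it has final colour at
-- least k (it passed entry k or stopped there) and hence exactly k, so its auxiliary
-- colour is f(k); b joins with f(k) too. The earlier twin makes this set of e have
-- two vertices, so it is monochromatic, contradicting properness of entry k.
module Submission where

open import Defs
open import Data.Nat using (ℕ; _<_; _≤_)
open import Data.Fin using (Fin; toℕ)
open import Data.Nat using (zero; suc; s≤s; _≤′_; ≤′-refl; ≤′-step; _≤?_; _<?_)
open import Data.Nat.Properties
  using (<⇒≤; ≤-refl; ≤-trans; <-trans; ≤-reflexive; ≤-antisym; <-irrefl; ≰⇒>; ≤⇒≤′; <-cmp; m<n⇒m<1+n)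
open import Data.Fin using (fromℕ<; _≟_) renaming (zero to fzero; suc to fsuc)
open import Data.Fin.Properties using (toℕ-fromℕ<; toℕ-injective; toℕ<n)
open import Data.Fin.Subset using (Subset; _∈_)
open import Data.Fin.Subset.Properties using (_∈?_)
open import Data.Maybe using (just)
open import Data.Maybe.Properties using (just-injective)
open import Data.Product using (∃; _×_; _,_; proj₁; map₁)
open import Data.Sum using (_⊎_; inj₁; inj₂)
open import Data.Empty using (⊥-elim)
open import Relation.Binary using (tri<; tri≈; tri>)
open import Relation.Binary.PropositionalEquality using (_≡_; _≢_; refl; sym; trans; cong; subst)
open import Relation.Nullary using (¬_; yes; no; Dec)
open import Relation.Nullary.Decidable using (_×-dec_)

extend-self : ∀ {n} {C : Set} (col : PartialColoring n C) v c → extend col v c v ≡ just c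
extend-self col v c with v ≟ v
... | yes _ = refl
... | no v≢v = ⊥-elim (v≢v refl)

extend-other : ∀ {n} {C : Set} (col : PartialColoring n C) {u v} c → u ≢ v → extend col v c u ≡ col u
extend-other col {u} {v} c u≢v with u ≟ v
... | yes u≡v = ⊥-elim (u≢v u≡v)
... | no _ = refl

argmax : ∀ {m} (g : Fin m → ℕ) {P : Fin m → Set} → (∀ x → Dec (P x)) →
         (∀ x → ¬ P x) ⊎ ∃ λ u → P u × (∀ w → P w → g w ≤ g u)
argmax {zero} g P? = inj₁ λ ()
argmax {suc m} g P? with argmax (λ x → g (fsuc x)) (λ x → P? (fsuc x)) | P? fzero
... | inj₁ none | yes p = inj₂ (fzero , p , λ { fzero _ → ≤-refl ; (fsuc w) pw → ⊥-elim (none w pw) })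
... | inj₁ none | no ¬p = inj₁ λ { fzero → ¬p ; (fsuc w) → none w }
... | inj₂ (u , pu , max) | no ¬p = inj₂ (fsuc u , pu , λ { fzero p → ⊥-elim (¬p p) ; (fsuc w) pw → max w pw })
... | inj₂ (u , pu , max) | yes p with g (fsuc u) ≤? g fzero
...   | yes le = inj₂ (fzero , p , λ { fzero _ → ≤-refl ; (fsuc w) pw → ≤-trans (max w pw) le })
...   | no ≰ = inj₂ (fsuc u , pu , λ { fzero _ → <⇒≤ (≰⇒> ≰) ; (fsuc w) pw → max w pw })

module _ {n h : ℕ} {H : Hypergraph n} {f : ℕ → Fin h} where

  entryUpdate-cases : ∀ {v k i old new} → EntryUpdate H f v k i old new →
    Unchanged old new ⊎ ∃ λ c → Added v c old new × i ≤ k × (i ≡ k → c ≡ f i)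
  entryUpdate-cases (inj₁ (_ , inj₁ (_ , unchanged))) = inj₁ unchanged
  entryUpdate-cases (inj₁ (i<k , inj₂ (c , _ , _ , added))) =
    inj₂ (c , added , <⇒≤ i<k , λ i≡k → ⊥-elim (<-irrefl i≡k i<k))
  entryUpdate-cases (inj₂ (inj₁ (refl , _ , added))) = inj₂ (_ , added , ≤-refl , λ _ → refl)
  entryUpdate-cases (inj₂ (inj₂ (_ , unchanged))) = inj₁ unchanged

  module _ (r : Run H f) where

    step-at : ∀ s (s<n : s < n) i →
      EntryUpdate H f (fromℕ< s<n) (final r (fromℕ< s<n)) i (aux r s i) (aux r (suc s) i)
    step-at s s<n i =
      subst (λ m → EntryUpdate H f (fromℕ< s<n) (final r (fromℕ< s<n)) i (aux r m i) (aux r (suc m) i))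
            (toℕ-fromℕ< s<n) (step r (fromℕ< s<n) i)

    aux-sound : ∀ s → s ≤ n → ∀ i u c → aux r s i u ≡ just c →
                toℕ u < s × i ≤ final r u × (i ≡ final r u → c ≡ f i)
    aux-sound zero _ i u c u↦c with trans (sym (init r i u)) u↦c
    ... | ()
    aux-sound (suc s) s<n i u c u↦c with entryUpdate-cases (step-at s s<n i)
    ... | inj₁ unchanged =
      map₁ m<n⇒m<1+n (aux-sound s (<⇒≤ s<n) i u c (trans (sym (unchanged u)) u↦c))
    ... | inj₂ (c′ , added , i≤k , i≡k⇒) with u ≟ fromℕ< s<n
    ...   | yes refl = u<1+s , i≤k , λ i≡k → trans (sym c′≡c) (i≡k⇒ i≡k)
      where
        u<1+s : toℕ u < suc s
        u<1+s = s≤s (≤-reflexive (toℕ-fromℕ< s<n))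
        c′≡c : c′ ≡ c
        c′≡c = just-injective (trans (sym (extend-self (aux r s i) u c′)) (trans (sym (added u)) u↦c))
    ...   | no u≢v =
      map₁ m<n⇒m<1+n
        (aux-sound s (<⇒≤ s<n) i u c (trans (sym (trans (added u) (extend-other (aux r s i) c′ u≢v))) u↦c))

    aux-step : ∀ s (s<n : s < n) i u c → aux r s i u ≡ just c → aux r (suc s) i u ≡ just c
    aux-step s s<n i u c u↦c with entryUpdate-cases (step-at s s<n i)
    ... | inj₁ unchanged = trans (unchanged u) u↦c
    ... | inj₂ (c′ , added , _) = trans (added u) (trans (extend-other (aux r s i) c′ u≢v) u↦c)
      where
        u≢v : u ≢ fromℕ< s<n
        u≢v refl = <-irrefl (toℕ-fromℕ< s<n) (proj₁ (aux-sound s (<⇒≤ s<n) i u c u↦c))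

    aux-mono : ∀ {s s′} → s ≤′ s′ → s′ ≤ n → ∀ i u c → aux r s i u ≡ just c → aux r s′ i u ≡ just c
    aux-mono ≤′-refl _ i u c u↦c = u↦c
    aux-mono (≤′-step s≤s′) s′<n i u c u↦c = aux-step _ s′<n i u c (aux-mono s≤s′ (<⇒≤ s′<n) i u c u↦c)

    entryBefore : Fin n → PartialColoring n (Fin h)
    entryBefore w = aux r (toℕ w) (final r w)

    entryWith : Fin n → PartialColoring n (Fin h)
    entryWith w = extend (entryBefore w) w (f (final r w))

    entryWith-proper : ∀ w → Proper H (entryWith w)
    entryWith-proper w with step r w (final r w)
    ... | inj₁ (k<k , _) = ⊥-elim (<-irrefl refl k<k)
    ... | inj₂ (inj₁ (_ , proper , _)) = proper
    ... | inj₂ (inj₂ (k<k , _)) = ⊥-elim (<-irrefl refl k<k)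

    final-colour-recorded : ∀ w → aux r (suc (toℕ w)) (final r w) w ≡ just (f (final r w))
    final-colour-recorded w with step r w (final r w)
    ... | inj₁ (k<k , _) = ⊥-elim (<-irrefl refl k<k)
    ... | inj₂ (inj₁ (_ , _ , added)) = trans (added w) (extend-self (entryBefore w) w _)
    ... | inj₂ (inj₂ (k<k , _)) = ⊥-elim (<-irrefl refl k<k)

    MaximalAmongEarlier : Subset n → Fin n → Set
    MaximalAmongEarlier S b = ∀ x → x ∈ S → toℕ x < toℕ b → final r x ≤ final r b

    entryWith-monochromatic : ∀ {S} b → MaximalAmongEarlier S b →
      ∀ x → x ∈ S → InDom (entryWith b) x → entryWith b x ≡ just (f (final r b))
    entryWith-monochromatic b maximal x x∈S (c , x↦c) with x ≟ b
    ... | yes _ = refl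
    ... | no _ with aux-sound (toℕ b) (<⇒≤ (toℕ<n b)) (final r b) x c x↦c
    ...   | x<b , k≤final-x , colour-if-final =
      trans x↦c (cong just (colour-if-final (≤-antisym k≤final-x (maximal x x∈S x<b))))

    no-earlier-twin : ∀ e {a b} → a ∈ edge H e → b ∈ edge H e → toℕ a < toℕ b →
                      final r a ≡ final r b → ¬ MaximalAmongEarlier (edge H e) b
    no-earlier-twin e {a} {b} a∈e b∈e a<b same maximal =
      entryWith-proper b e (a , b , a≢b , a∈e , b∈e , (_ , a↦k) , (_ , extend-self _ b _))
                           (_ , entryWith-monochromatic b maximal)
      where
        a≢b : a ≢ b
        a≢b refl = <-irrefl refl a<b
        a↦k : entryWith b a ≡ just (f (final r b))
        a↦k = trans (extend-other _ _ a≢b)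
                (aux-mono (≤⇒≤′ a<b) (<⇒≤ (toℕ<n b)) (final r b) a _
                  (subst (λ k → aux r (suc (toℕ a)) k a ≡ just (f k)) same (final-colour-recorded a)))

mainTheorem6 : (n h : ℕ) → 1 ≤ h → (H : Hypergraph n) → (f : ℕ → Fin h) →
               (r : Run H f) → (t : ℕ) → 1 ≤ t → t ≤ n →
               ConflictFreeOn H (λ u → toℕ u < t) (final r)
mainTheorem6 n h _ H f r t _ _ e (u₀ , u₀∈e , u₀<t)
  with argmax (final r) (λ x → (x ∈? edge H e) ×-dec (toℕ x <? t))
... | inj₁ none = ⊥-elim (none u₀ (u₀∈e , u₀<t))
... | inj₂ (u , (u∈e , u<t) , max) = u , u∈e , u<t , unique
  where
    unique : ∀ w → w ∈ edge H e → toℕ w < t → w ≢ u → final r w ≢ final r u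
    unique w w∈e w<t w≢u same with <-cmp (toℕ w) (toℕ u)
    ... | tri< w<u _ _ = no-earlier-twin r e w∈e u∈e w<u same
                           λ x x∈e x<u → max x (x∈e , <-trans x<u u<t)
    ... | tri≈ _ w≡u _ = w≢u (toℕ-injective w≡u)
    ... | tri> _ _ u<w = no-earlier-twin r e u∈e w∈e u<w (sym same)
                           λ x x∈e x<w → ≤-trans (max x (x∈e , <-trans x<w w<t)) (≤-reflexive (sym same))
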